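{- Let $\mathcal C\subseteq\mathbb{F}_q^n$ be a $q$-ary constant-weight code of length $n$ and constant weight $w$, with $M=|\mathcal C|$. Then for each $k=1,2,\dots,n$, $$\sum_{\alpha\in(\mathbb{F}_q^*)^k}\ \sum_{1\le i_1<\cdots<i_k\le n}\ \sum_{c=2}^{q} x_c(\alpha_1u'_{i_1}+\cdots+\alpha_ku'_{i_k})=\frac{2(q-1)}{q}\,M\,P_k^-(n;w).$$
   Context: $\mathbb{F}_q$ is a finite field with $q$ elements, $\mathbb{F}_q^*=\mathbb{F}_q\setminus\{0\}$, enumerated as $\mathbb{F}_q=\{0=\omega_1,\omega_2,\dots,\omega_q\}$. A $q$-ary constant-weight code of length $n$ and weight $w$ is a subset of $\mathbb{F}_q^n$ all of whose elements have exactly $w$ nonzero coordinates. Regard $\mathcal C$ as an $M\times n$ matrix whose rows are the codewords; its columns are $u'_1,\dots,u'_n\in\mathbb{F}_q^M$. For $a=(a_1,\dots,a_M)\in\mathbb{F}_q^M$ and $c\in\{1,\dots,q\}$, $x_c(a)=|\{j: a_j=\omega_c\}|$. Also $P_k^-(n;x)=\frac12\sum_{j=0}^k\left[(q-1)^j-(-1)^j\right](q-1)^{k-j}\binom{x}{j}\binom{n-x}{k-j}$. -}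

module Defs where

open import Level using (0ℓ)
open import Data.Nat as ℕ using (ℕ; zero; suc; _<_; NonZero)
open import Data.Nat.Combinatorics using (_C_)
open import Data.Fin using (Fin; toℕ) renaming (zero to fzero; suc to fsuc)
open import Data.Fin.Properties using () renaming (_≟_ to _≟ᶠ_)
open import Data.Integer as ℤ using (ℤ; +_)
open import Data.Rational as ℚ using (ℚ; _/_)
open import Data.Bool using (Bool; true; false; if_then_else_; _∧_)
open import Data.Product using (Σ; ∃; _×_)
open import Relation.Nullary using (¬_; does)
open import Relation.Binary using (Decidable)
open import Relation.Binary.PropositionalEquality using (_≡_)
open import Algebra.Bundles using (CommutativeRing)

-- Finite fields F_q, with an enumeration F_q = {ω₁ = 0, ω₂, …, ω_q}.
-- (Fin q is 0-indexed: ω (index 0) = ω₁ = 0.)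

record FiniteField : Set₁ where
  field
    cring : CommutativeRing 0ℓ 0ℓ
  open CommutativeRing cring public
  field
    _≟_     : Decidable _≈_
    0≉1     : ¬ (0# ≈ 1#)
    inverse : ∀ x → ¬ (x ≈ 0#) → ∃ λ y → (x * y) ≈ 1#
    q       : ℕ
    q-nz    : NonZero q
    ω       : Fin q → Carrier
    ω-inj   : ∀ i j → ω i ≈ ω j → i ≡ j
    ω-surj  : ∀ x → ∃ λ i → ω i ≈ x
    ω₁≈0    : ∀ (i : Fin q) → toℕ i ≡ 0 → ω i ≈ 0#

ΣFin : (n : ℕ) → (Fin n → ℕ) → ℕ
ΣFin zero    f = 0
ΣFin (suc n) f = f fzero ℕ.+ ΣFin n (λ i → f (fsuc i))

ΣFun : (k m : ℕ) → ((Fin k → Fin m) → ℕ) → ℕ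
ΣFun zero    m f = f (λ ())
ΣFun (suc k) m f = ΣFin m (λ a → ΣFun k m (λ g → f (cons a g)))
  where
  cons : Fin m → (Fin k → Fin m) → Fin (suc k) → Fin m
  cons a g fzero    = a
  cons a g (fsuc i) = g i

Σℤ : (k : ℕ) → (ℕ → ℤ) → ℤ
Σℤ zero    f = f 0
Σℤ (suc k) f = Σℤ k f ℤ.+ f (suc k)

indicator : Bool → ℕ
indicator true  = 1
indicator false = 0

allFin : (m : ℕ) → (Fin m → Bool) → Bool
allFin zero    _ = true
allFin (suc m) h = h fzero ∧ allFin m (λ i → h (fsuc i))

_⇒ᵇ_ : Bool → Bool → Bool
true  ⇒ᵇ b = b
false ⇒ᵇ b = true

-- ι : Fin k → Fin n is strictly increasing, i.e. encodes 1 ≤ i₁ < ⋯ < i_k ≤ n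
isStrictlyIncreasing : ∀ {k n} → (Fin k → Fin n) → Bool
isStrictlyIncreasing {k} ι =
  allFin k (λ s → allFin k (λ t →
    does (toℕ s ℕ.<? toℕ t) ⇒ᵇ does (toℕ (ι s) ℕ.<? toℕ (ι t))))

module _ (F : FiniteField) where
  open FiniteField F

  nz : Carrier → ℕ
  nz x = if does (x ≟ 0#) then 0 else 1

  wt : ∀ {n} → (Fin n → Carrier) → ℕ
  wt {n} v = ΣFin n (λ l → nz (v l))

  record ConstantWeightCode (M n w : ℕ) : Set where
    field
      row      : Fin M → Fin n → Carrier
      distinct : ∀ i j → (∀ l → row i l ≈ row j l) → i ≡ j
      weight   : ∀ i → wt (row i) ≡ w

  column : ∀ {M n w} → ConstantWeightCode M n w → Fin n → Fin M → Carrier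
  column 𝒞 l j = ConstantWeightCode.row 𝒞 j l

  x : ∀ {M} → Fin q → (Fin M → Carrier) → ℕ
  x {M} c a = ΣFin M (λ j → if does (a j ≟ ω c) then 1 else 0)

  Σx : ∀ {M} → (Fin M → Carrier) → ℕ
  Σx a = ΣFin q (λ c → if does (toℕ c ℕ.≟ 0) then 0 else x c a)

  ΣF : (k : ℕ) → (Fin k → Carrier) → Carrier
  ΣF zero    f = 0#
  ΣF (suc k) f = f fzero + ΣF k (λ i → f (fsuc i))

  lincomb : ∀ {M n w k} → ConstantWeightCode M n w → (Fin k → Carrier) → (Fin k → Fin n) → Fin M → Carrier
  lincomb {k = k} 𝒞 α ι j = ΣF k (λ t → α t * column 𝒞 (ι t) j)

  allNonzero : ∀ {k} → (Fin k → Fin q) → Bool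
  allNonzero {k} β = allFin k (λ t → nz (ω (β t)) ℕ.≡ᵇ 1)

  -- LHS: Σ_{α ∈ (F_q^*)^k} Σ_{i₁<⋯<i_k} Σ_{c=2}^q x_c(α₁u'_{i₁}+⋯+α_k u'_{i_k})
  -- (α ranges over F_q^k via the bijection ω, restricted to nonzero entries)
  LHS : ∀ {M n w} → ConstantWeightCode M n w → (k : ℕ) → ℕ
  LHS {n = n} 𝒞 k =
    ΣFun k q (λ β → if allNonzero β then
      ΣFun k n (λ ι → if isStrictlyIncreasing ι then Σx (lincomb 𝒞 (λ t → ω (β t)) ι) else 0)
    else 0)

  Pminus : (k n x : ℕ) → ℚ
  Pminus k n x' = ℚ.½ ℚ.* (Σℤ k term / 1)
    where
    term : ℕ → ℤ
    term j = ((+ (q ℕ.∸ 1)) ℤ.^ j ℤ.- (ℤ.- (+ 1)) ℤ.^ j)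
             ℤ.* (+ ((q ℕ.∸ 1) ℕ.^ (k ℕ.∸ j)))
             ℤ.* (+ (x' C j)) ℤ.* (+ ((n ℕ.∸ x') C (k ℕ.∸ j)))

  RHS : (M n w k : ℕ) → ℚ
  RHS M n w k = (_/_ (+ (2 ℕ.* (q ℕ.∸ 1))) q {{q-nz}}) ℚ.* (+ M / 1) ℚ.* Pminus k n w

-- Summing x_c over c ≥ 2 counts the nonzero entries, so the left-hand side counts the
-- triples (row j, indices i₁ < ⋯ < i_k, α ∈ (F*)^k) with α₁ c_{j i₁} + ⋯ + α_k c_{j i_k} ≠ 0.
-- If the indices meet the support of row j in m places, the other k - m coordinates of α are
-- free, so there are (q-1)^(k-m) N_m such α, where N_m counts the m-tuples of nonzero field
-- elements with nonzero sum. Recording whether the partial sums vanish gives a two-term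
-- recurrence for N_m with solution q N_m = (q-1)((q-1)^m - (-1)^m). A row of weight w has
-- C(w,m) C(n-w,k-m) index sets meeting its support in m places, so every row contributes the
-- same amount.

module Submission where

open import Defs
open import Data.Bool using (Bool; true; false; T; not; _∧_; if_then_else_)
open import Data.Bool.Properties using (T-∧; T-not-≡)
open import Data.Empty using (⊥-elim)
open import Data.Fin as Fin using (Fin; toℕ) renaming (zero to fzero; suc to fsuc)
open import Data.Fin.Properties using () renaming (suc-injective to fsuc-injective)
open import Data.Integer as ℤ using (ℤ; +_)
import Data.Integer.Properties as ℤₚ
open import Data.Integer.Properties using (pos-+; pos-*)
open import Data.Integer.Tactic.RingSolver using (solve-∀)
open import Data.Nat as ℕ using (ℕ; zero; suc; _+_; _*_; _∸_; _^_; _≤_; z≤n; s≤s; s<s; s<s⁻¹)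
open import Data.Nat.Combinatorics using (_C_; nCk+nC[k+1]≡[n+1]C[k+1])
open import Data.Nat.Properties
  using (+-identityʳ; +-assoc; +-comm; +-suc; *-zeroʳ; *-identityʳ; *-comm; *-assoc; *-suc; *-distribʳ-+; *-distribˡ-+;
         m≤n⇒m≤1+n; 0≢1+n; n≮0; +-∸-assoc; ≤-trans; ≤-reflexive;
         +-0-commutativeMonoid; +-commutativeSemigroup; *-commutativeSemigroup; +-*-semiring)
open import Data.Product using (∃; _×_; _,_; proj₁; proj₂)
open import Data.Rational as ℚ using (_/_; ½; toℚᵘ)
open import Data.Rational.Properties using (toℚᵘ-injective; toℚᵘ-fromℚᵘ; toℚᵘ-homo-*)
open import Data.Rational.Unnormalised as ℚᵘ using (mkℚᵘ; _≃_; *≡*)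
open import Data.Rational.Unnormalised.Properties using (*-cong; module ≃-Reasoning)
open import Data.Vec.Functional using (_∷_)
open import Function using (_∘_)
open import Function.Bundles using (Equivalence)
open import Relation.Nullary using (¬_; Dec; yes; no; does)
open import Relation.Binary.PropositionalEquality
open import Algebra.Properties.CommutativeMonoid.Sum +-0-commutativeMonoid using (sum; ∑-comm)
open import Algebra.Properties.CommutativeSemigroup +-commutativeSemigroup
  using () renaming (interchange to +-interchange; x∙yz≈y∙xz to x+[y+z]≡y+[x+z])
open import Algebra.Properties.CommutativeSemigroup *-commutativeSemigroup
  using () renaming (x∙yz≈y∙xz to x*[y*z]≡y*[x*z])
open import Algebra.Properties.CommutativeSemigroup ℤₚ.*-commutativeSemigroup
  using () renaming (x∙yz≈y∙xz to ℤ-x*[y*z]≡y*[x*z])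
open import Algebra.Properties.Semiring.Sum +-*-semiring using (*-distribˡ-sum)

ΣFin≡sum : ∀ n (f : Fin n → ℕ) → ΣFin n f ≡ sum f
ΣFin≡sum zero    f = refl
ΣFin≡sum (suc n) f = cong (_+_ (f fzero)) (ΣFin≡sum n (f ∘ fsuc))

ΣFin-cong : ∀ n {f g : Fin n → ℕ} → f ≗ g → ΣFin n f ≡ ΣFin n g
ΣFin-cong zero    f≗g = refl
ΣFin-cong (suc n) f≗g = cong₂ _+_ (f≗g fzero) (ΣFin-cong n (f≗g ∘ fsuc))

ΣFin-const : ∀ n c → ΣFin n (λ _ → c) ≡ n * c
ΣFin-const zero    c = refl
ΣFin-const (suc n) c = cong (_+_ c) (ΣFin-const n c)

ΣFin-*ˡ : ∀ n c (f : Fin n → ℕ) → ΣFin n (λ i → c * f i) ≡ c * ΣFin n f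
ΣFin-*ˡ n c f = begin
  ΣFin n (λ i → c * f i) ≡⟨ ΣFin≡sum n _ ⟩
  sum (λ i → c * f i)    ≡⟨ *-distribˡ-sum c f ⟨
  c * sum f              ≡⟨ cong (c *_) (ΣFin≡sum n f) ⟨
  c * ΣFin n f           ∎
  where open ≡-Reasoning

ΣFin-comm : ∀ m n (f : Fin m → Fin n → ℕ) →
            ΣFin m (λ i → ΣFin n (f i)) ≡ ΣFin n (λ j → ΣFin m (λ i → f i j))
ΣFin-comm m n f = begin
  ΣFin m (λ i → ΣFin n (f i))           ≡⟨ ΣFin-cong m (λ i → ΣFin≡sum n (f i)) ⟩
  ΣFin m (λ i → sum (f i))              ≡⟨ ΣFin≡sum m _ ⟩
  sum (λ i → sum (f i))                 ≡⟨ ∑-comm f ⟩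
  sum (λ j → sum (λ i → f i j))         ≡⟨ ΣFin≡sum n _ ⟨
  ΣFin n (λ j → sum (λ i → f i j))      ≡⟨ ΣFin-cong n (λ j → ΣFin≡sum m (λ i → f i j)) ⟨
  ΣFin n (λ j → ΣFin m (λ i → f i j))   ∎
  where open ≡-Reasoning

ΣFun-cong : ∀ k m {f g : (Fin k → Fin m) → ℕ} → (∀ ι → f ι ≡ g ι) → ΣFun k m f ≡ ΣFun k m g
ΣFun-cong zero    m f≗g = f≗g _
ΣFun-cong (suc k) m f≗g = ΣFin-cong m (λ a → ΣFun-cong k m (λ ι → f≗g _))

ΣFun-*ˡ : ∀ k m c (f : (Fin k → Fin m) → ℕ) → ΣFun k m (λ ι → c * f ι) ≡ c * ΣFun k m f
ΣFun-*ˡ zero    m c f = refl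
ΣFun-*ˡ (suc k) m c f = trans (ΣFin-cong m (λ a → ΣFun-*ˡ k m c _)) (ΣFin-*ˡ m c _)

ΣFun-zero : ∀ k m {f : (Fin k → Fin m) → ℕ} → (∀ ι → f ι ≡ 0) → ΣFun k m f ≡ 0
ΣFun-zero zero    m f≡0 = f≡0 _
ΣFun-zero (suc k) m f≡0 =
  trans (ΣFin-cong m (λ a → ΣFun-zero k m (λ ι → f≡0 _))) (trans (ΣFin-const m 0) (*-zeroʳ m))

ΣFun-ΣFin : ∀ k m n (f : (Fin k → Fin m) → Fin n → ℕ) →
            ΣFun k m (λ ι → ΣFin n (f ι)) ≡ ΣFin n (λ j → ΣFun k m (λ ι → f ι j))
ΣFun-ΣFin zero    m n f = refl
ΣFun-ΣFin (suc k) m n f = trans (ΣFin-cong m (λ a → ΣFun-ΣFin k m n _)) (ΣFin-comm m n _)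

ΣFun-comm : ∀ k m k′ m′ (f : (Fin k → Fin m) → (Fin k′ → Fin m′) → ℕ) →
            ΣFun k m (λ ι → ΣFun k′ m′ (f ι)) ≡ ΣFun k′ m′ (λ κ → ΣFun k m (λ ι → f ι κ))
ΣFun-comm zero    m k′ m′ f = refl
ΣFun-comm (suc k) m k′ m′ f =
  trans (ΣFin-cong m (λ a → ΣFun-comm k m k′ m′ _)) (sym (ΣFun-ΣFin k′ m′ m _))

Extensional : ∀ {k m} → ((Fin k → Fin m) → ℕ) → Set
Extensional f = ∀ {ι κ} → ι ≗ κ → f ι ≡ f κ

∷-cong : ∀ {k n} (a : Fin n) {ι κ : Fin k → Fin n} → ι ≗ κ → (a ∷ ι) ≗ (a ∷ κ)
∷-cong a ι≗κ fzero    = refl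
∷-cong a ι≗κ (fsuc t) = ι≗κ t

ΣFun-suc : ∀ k m (f : (Fin (suc k) → Fin m) → ℕ) → Extensional f →
           ΣFun (suc k) m f ≡ ΣFin m (λ a → ΣFun k m (λ ι → f (a ∷ ι)))
ΣFun-suc k m f ext = ΣFin-cong m (λ a → ΣFun-cong k m (λ ι → ext λ { fzero → refl ; (fsuc t) → refl }))

ΣFun-avoiding-fzero : ∀ k n (f : (Fin k → Fin (suc n)) → ℕ) → Extensional f →
                      (∀ ι t → ι t ≡ fzero → f ι ≡ 0) →
                      ΣFun k (suc n) f ≡ ΣFun k n (λ ι → f (fsuc ∘ ι))
ΣFun-avoiding-fzero zero    n f ext vanish = ext (λ ())
ΣFun-avoiding-fzero (suc k) n f ext vanish = begin
  ΣFun (suc k) (suc n) f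
    ≡⟨ ΣFun-suc k (suc n) f ext ⟩
  ΣFun k (suc n) (λ ι → f (fzero ∷ ι)) + ΣFin n (λ a → ΣFun k (suc n) (λ ι → f (fsuc a ∷ ι)))
    ≡⟨ cong₂ _+_ (ΣFun-zero k (suc n) (λ ι → vanish _ fzero refl))
                 (ΣFin-cong n (λ a → ΣFun-avoiding-fzero k n _ (ext ∘ ∷-cong (fsuc a)) (λ ι t → vanish _ (fsuc t)))) ⟩
  ΣFin n (λ a → ΣFun k n (λ ι → f (fsuc a ∷ fsuc ∘ ι)))
    ≡⟨ ΣFin-cong n (λ a → ΣFun-cong k n (λ ι → ext λ { fzero → refl ; (fsuc t) → refl })) ⟩
  ΣFin n (λ a → ΣFun k n (λ ι → f (fsuc ∘ (a ∷ ι))))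
    ≡⟨ ΣFun-suc k n (λ ι → f (fsuc ∘ ι)) (λ ι≗κ → ext (cong fsuc ∘ ι≗κ)) ⟨
  ΣFun (suc k) n (λ ι → f (fsuc ∘ ι))
    ∎
  where open ≡-Reasoning

T-does⁻ : ∀ {A : Set} (d : Dec A) → T (does d) → A
T-does⁻ (yes a) _ = a

T-does⁺ : ∀ {A : Set} (d : Dec A) → A → T (does d)
T-does⁺ (yes _)  _ = _
T-does⁺ (no ¬a) a = ¬a a

T-not⁻ : ∀ {b} → T (not b) → ¬ T b
T-not⁻ {false} _ ()

T-not⁺ : ∀ {b} → ¬ T b → T (not b)
T-not⁺ {false} _  = _
T-not⁺ {true}  ¬t = ¬t _

≡-by-T : ∀ {b c} → (T b → T c) → (T c → T b) → b ≡ c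
≡-by-T {false} {false} _ _ = refl
≡-by-T {false} {true}  _ g = ⊥-elim (g _)
≡-by-T {true}  {false} f _ = ⊥-elim (f _)
≡-by-T {true}  {true}  _ _ = refl

T-allFin⁻ : ∀ m {h : Fin m → Bool} → T (allFin m h) → ∀ i → T (h i)
T-allFin⁻ (suc m) all fzero    = proj₁ (Equivalence.to T-∧ all)
T-allFin⁻ (suc m) all (fsuc i) = T-allFin⁻ m (proj₂ (Equivalence.to T-∧ all)) i

T-allFin⁺ : ∀ m {h : Fin m → Bool} → (∀ i → T (h i)) → T (allFin m h)
T-allFin⁺ zero    all = _
T-allFin⁺ (suc m) all = Equivalence.from T-∧ (all fzero , T-allFin⁺ m (all ∘ fsuc))

T-⇒ᵇ⁻ : ∀ {b c} → T (b ⇒ᵇ c) → T b → T c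
T-⇒ᵇ⁻ {true} b⇒c _ = b⇒c

T-⇒ᵇ⁺ : ∀ {b c} → (T b → T c) → T (b ⇒ᵇ c)
T-⇒ᵇ⁺ {true}  b→c = b→c _
T-⇒ᵇ⁺ {false} b→c = _

if≡indicator* : ∀ b c → (if b then c else 0) ≡ indicator b * c
if≡indicator* true  c = sym (+-identityʳ c)
if≡indicator* false c = refl

if-0≡indicator-not* : ∀ b c → (if b then 0 else c) ≡ indicator (not b) * c
if-0≡indicator-not* true  c = refl
if-0≡indicator-not* false c = sym (+-identityʳ c)

if-1-0≡indicator : ∀ b → (if b then 1 else 0) ≡ indicator b
if-1-0≡indicator true  = refl
if-1-0≡indicator false = refl

indicator-∧ : ∀ a b → indicator (a ∧ b) ≡ indicator a * indicator b
indicator-∧ true  b = sym (+-identityʳ _)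
indicator-∧ false b = refl

count : ∀ n → (Fin n → Bool) → ℕ
count n P = ΣFin n (indicator ∘ P)

count≤ : ∀ n P → count n P ≤ n
count≤ zero    P = z≤n
count≤ (suc n) P with P fzero
... | true  = s≤s (count≤ n (P ∘ fsuc))
... | false = m≤n⇒m≤1+n (count≤ n (P ∘ fsuc))

count-none : ∀ n {P : Fin n → Bool} → (∀ a → ¬ T (P a)) → count n P ≡ 0
count-none zero    never = refl
count-none (suc n) {P} never with P fzero | never fzero
... | true  | ¬T = ⊥-elim (¬T _)
... | false | _  = count-none n (never ∘ fsuc)

count-unique : ∀ n {P : Fin n → Bool} (a₀ : Fin n) → T (P a₀) → (∀ a → T (P a) → a ≡ a₀) →
               count n P ≡ 1
count-unique (suc n) {P} fzero Pa₀ unique with P fzero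
... | true = cong suc (count-none n (λ a Pa → 0≢1+n (cong toℕ (sym (unique (fsuc a) Pa)))))
count-unique (suc n) {P} (fsuc a₀) Pa₀ unique with P fzero | unique fzero
... | true  | u = ⊥-elim (0≢1+n (cong toℕ (u _)))
... | false | _ = count-unique n a₀ Pa₀ (λ a Pa → fsuc-injective (unique (fsuc a) Pa))

count-∧-split : ∀ n (P Q : Fin n → Bool) →
                count n (λ a → P a ∧ Q a) + count n (λ a → P a ∧ not (Q a)) ≡ count n P
count-∧-split zero    P Q = refl
count-∧-split (suc n) P Q with P fzero | Q fzero | count-∧-split n (P ∘ fsuc) (Q ∘ fsuc)
... | false | _     | ih = ih
... | true  | true  | ih = cong suc ih
... | true  | false | ih = trans (+-suc _ _) (cong suc ih)

ΣFin-indicator-split : ∀ n (P Q : Fin n → Bool) (g : Bool → ℕ) →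
                       ΣFin n (λ a → indicator (P a) * g (Q a))
                       ≡ g true * count n (λ a → P a ∧ Q a) + g false * count n (λ a → P a ∧ not (Q a))
ΣFin-indicator-split zero    P Q g = sym (cong₂ _+_ (*-zeroʳ (g true)) (*-zeroʳ (g false)))
ΣFin-indicator-split (suc n) P Q g with P fzero | Q fzero
... | false | _     = ΣFin-indicator-split n (P ∘ fsuc) (Q ∘ fsuc) g
... | true  | true  = begin
  g true + 0 + ΣFin n (λ a → indicator (P (fsuc a)) * g (Q (fsuc a)))
    ≡⟨ cong₂ _+_ (+-identityʳ (g true)) (ΣFin-indicator-split n (P ∘ fsuc) (Q ∘ fsuc) g) ⟩
  g true + (g true * c + g false * d)      ≡⟨ +-assoc (g true) _ _ ⟨
  g true + g true * c + g false * d        ≡⟨ cong (_+ g false * d) (*-suc (g true) c) ⟨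
  g true * suc c + g false * d             ∎
  where open ≡-Reasoning
        c = count n (λ a → P (fsuc a) ∧ Q (fsuc a))
        d = count n (λ a → P (fsuc a) ∧ not (Q (fsuc a)))
... | true  | false = begin
  g false + 0 + ΣFin n (λ a → indicator (P (fsuc a)) * g (Q (fsuc a)))
    ≡⟨ cong₂ _+_ (+-identityʳ (g false)) (ΣFin-indicator-split n (P ∘ fsuc) (Q ∘ fsuc) g) ⟩
  g false + (g true * c + g false * d)      ≡⟨ x+[y+z]≡y+[x+z] (g false) (g true * c) (g false * d) ⟩
  g true * c + (g false + g false * d)      ≡⟨ cong (_+_ (g true * c)) (*-suc (g false) d) ⟨
  g true * c + g false * suc d              ∎
  where open ≡-Reasoning
        c = count n (λ a → P (fsuc a) ∧ Q (fsuc a))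
        d = count n (λ a → P (fsuc a) ∧ not (Q (fsuc a)))

ΣFin-indicator-*ʳ : ∀ n (P : Fin n → Bool) c → ΣFin n (λ a → indicator (P a) * c) ≡ count n P * c
ΣFin-indicator-*ʳ n P c = begin
  ΣFin n (λ a → indicator (P a) * c) ≡⟨ ΣFin-cong n (λ a → *-comm (indicator (P a)) c) ⟩
  ΣFin n (λ a → c * indicator (P a)) ≡⟨ ΣFin-*ˡ n c (indicator ∘ P) ⟩
  c * count n P                      ≡⟨ *-comm c (count n P) ⟩
  count n P * c                      ∎
  where open ≡-Reasoning

∃toℕ≡0 : ∀ {n} → Fin n → ∃ λ (i : Fin n) → toℕ i ≡ 0
∃toℕ≡0 {suc n} _ = fzero , refl

two-distinct⇒≥2 : ∀ {n} {i j : Fin n} → i ≢ j → ∃ λ r → n ≡ suc (suc r)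
two-distinct⇒≥2 {suc zero}    {fzero} {fzero} i≢j = ⊥-elim (i≢j refl)
two-distinct⇒≥2 {suc (suc r)}                 _   = r , refl

StrictlyIncreasing : ∀ {k n} → (Fin k → Fin n) → Set
StrictlyIncreasing {k} ι = ∀ {s t : Fin k} → s Fin.< t → ι s Fin.< ι t

isStrictlyIncreasing⁻ : ∀ {k n} {ι : Fin k → Fin n} → T (isStrictlyIncreasing ι) → StrictlyIncreasing ι
isStrictlyIncreasing⁻ {k} inc {s} {t} s<t =
  T-does⁻ (_ ℕ.<? _) (T-⇒ᵇ⁻ (T-allFin⁻ k (T-allFin⁻ k inc s) t) (T-does⁺ (_ ℕ.<? _) s<t))

isStrictlyIncreasing⁺ : ∀ {k n} {ι : Fin k → Fin n} → StrictlyIncreasing ι → T (isStrictlyIncreasing ι)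
isStrictlyIncreasing⁺ {k} inc = T-allFin⁺ k λ s → T-allFin⁺ k λ t →
  T-⇒ᵇ⁺ λ s<t → T-does⁺ (_ ℕ.<? _) (inc (T-does⁻ (_ ℕ.<? _) s<t))

isStrictlyIncreasing-≡ : ∀ {k k′ n n′} (ι : Fin k → Fin n) (κ : Fin k′ → Fin n′) →
                         (StrictlyIncreasing ι → StrictlyIncreasing κ) →
                         (StrictlyIncreasing κ → StrictlyIncreasing ι) →
                         isStrictlyIncreasing ι ≡ isStrictlyIncreasing κ
isStrictlyIncreasing-≡ ι κ ι⇒κ κ⇒ι = ≡-by-T (isStrictlyIncreasing⁺ ∘ ι⇒κ ∘ isStrictlyIncreasing⁻)
                                        (isStrictlyIncreasing⁺ ∘ κ⇒ι ∘ isStrictlyIncreasing⁻)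

isStrictlyIncreasing-cong : ∀ {k n} {ι κ : Fin k → Fin n} → ι ≗ κ → isStrictlyIncreasing ι ≡ isStrictlyIncreasing κ
isStrictlyIncreasing-cong {ι = ι} {κ} ι≗κ = isStrictlyIncreasing-≡ ι κ
  (λ inc {s} {t} s<t → subst₂ Fin._<_ (ι≗κ s) (ι≗κ t) (inc s<t))
  (λ inc {s} {t} s<t → subst₂ Fin._<_ (sym (ι≗κ s)) (sym (ι≗κ t)) (inc s<t))

isStrictlyIncreasing-fsuc∘ : ∀ {k n} (ι : Fin k → Fin n) → isStrictlyIncreasing (fsuc ∘ ι) ≡ isStrictlyIncreasing ι
isStrictlyIncreasing-fsuc∘ ι = isStrictlyIncreasing-≡ (fsuc ∘ ι) ι (λ inc → s<s⁻¹ ∘ inc) (λ inc → s<s ∘ inc)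

isStrictlyIncreasing-fzero∷ : ∀ {k n} (ι : Fin k → Fin n) →
                              isStrictlyIncreasing (fzero ∷ fsuc ∘ ι) ≡ isStrictlyIncreasing ι
isStrictlyIncreasing-fzero∷ ι = isStrictlyIncreasing-≡ (fzero ∷ fsuc ∘ ι) ι (λ inc → s<s⁻¹ ∘ inc ∘ s<s) extend
  where
  extend : StrictlyIncreasing ι → StrictlyIncreasing (fzero ∷ fsuc ∘ ι)
  extend inc {fzero}  {fsuc t} _   = s≤s z≤n
  extend inc {fsuc s} {fsuc t} s<t = s<s (inc (s<s⁻¹ s<t))

¬isStrictlyIncreasing-∷ : ∀ {k n} (a : Fin (suc n)) (ι : Fin k → Fin (suc n)) t → ι t ≡ fzero →
                          ¬ T (isStrictlyIncreasing (a ∷ ι))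
¬isStrictlyIncreasing-∷ a ι t ιt≡0 inc = n≮0 (subst (λ i → toℕ a ℕ.< toℕ i) ιt≡0
  (isStrictlyIncreasing⁻ {ι = a ∷ ι} inc {fzero} {fsuc t} (s≤s z≤n)))

ΣIncreasing : (k n : ℕ) → ((Fin k → Fin n) → ℕ) → ℕ
ΣIncreasing k n f = ΣFun k n (λ ι → indicator (isStrictlyIncreasing ι) * f ι)

ΣIncreasing-suc : ∀ k n (f : (Fin (suc k) → Fin (suc n)) → ℕ) → Extensional f →
                  ΣIncreasing (suc k) (suc n) f
                  ≡ ΣIncreasing k n (λ ι → f (fzero ∷ fsuc ∘ ι)) + ΣIncreasing (suc k) n (λ ι → f (fsuc ∘ ι))
ΣIncreasing-suc k n f ext = begin
  ΣFun (suc k) (suc n) g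
    ≡⟨ ΣFun-suc k (suc n) g g-ext ⟩
  ΣFun k (suc n) (λ ι → g (fzero ∷ ι)) + ΣFin n (λ a → ΣFun k (suc n) (λ ι → g (fsuc a ∷ ι)))
    ≡⟨ cong₂ _+_ (ΣFun-avoiding-fzero k n _ (g-ext ∘ ∷-cong fzero) (vanish fzero))
                 (ΣFin-cong n (λ a → ΣFun-avoiding-fzero k n _ (g-ext ∘ ∷-cong (fsuc a)) (vanish (fsuc a)))) ⟩
  ΣFun k n (λ ι → g (fzero ∷ fsuc ∘ ι)) + ΣFin n (λ a → ΣFun k n (λ ι → g (fsuc a ∷ fsuc ∘ ι)))
    ≡⟨ cong₂ _+_ (ΣFun-cong k n (λ ι → cong (λ b → indicator b * f (fzero ∷ fsuc ∘ ι)) (isStrictlyIncreasing-fzero∷ ι)))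
                 (ΣFin-cong n (λ a → ΣFun-cong k n (λ ι → shift a ι))) ⟩
  ΣIncreasing k n (λ ι → f (fzero ∷ fsuc ∘ ι)) + ΣFin n (λ a → ΣFun k n (λ ι → g′ (a ∷ ι)))
    ≡⟨ cong (_+_ (ΣIncreasing k n (λ ι → f (fzero ∷ fsuc ∘ ι)))) (ΣFun-suc k n g′ g′-ext) ⟨
  ΣIncreasing k n (λ ι → f (fzero ∷ fsuc ∘ ι)) + ΣIncreasing (suc k) n (λ ι → f (fsuc ∘ ι))
    ∎
  where
  open ≡-Reasoning
  g : (Fin (suc k) → Fin (suc n)) → ℕ
  g ι = indicator (isStrictlyIncreasing ι) * f ι
  g′ : (Fin (suc k) → Fin n) → ℕ
  g′ ι = indicator (isStrictlyIncreasing ι) * f (fsuc ∘ ι)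
  g-ext : Extensional g
  g-ext ι≗κ = cong₂ _*_ (cong indicator (isStrictlyIncreasing-cong ι≗κ)) (ext ι≗κ)
  g′-ext : Extensional g′
  g′-ext ι≗κ = g-ext (cong fsuc ∘ ι≗κ)
  vanish : ∀ a ι t → ι t ≡ fzero → g (a ∷ ι) ≡ 0
  vanish a ι t ιt≡0 = cong (λ b → indicator b * f (a ∷ ι))
                           (Equivalence.to T-not-≡ (T-not⁺ (¬isStrictlyIncreasing-∷ a ι t ιt≡0)))
  shift : ∀ a ι → g (fsuc a ∷ fsuc ∘ ι) ≡ g′ (a ∷ ι)
  shift a ι = g-ext λ { fzero → refl ; (fsuc t) → refl }

convolution : ℕ → (ℕ → ℕ) → (ℕ → ℕ) → ℕ
convolution zero    f g = f 0 * g 0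
convolution (suc k) f g = f 0 * g (suc k) + convolution k (f ∘ suc) g

delay : (ℕ → ℕ) → ℕ → ℕ
delay h zero    = 0
delay h (suc j) = h j

convolution-cong : ∀ k {f f′ g g′ : ℕ → ℕ} → f ≗ f′ → g ≗ g′ → convolution k f g ≡ convolution k f′ g′
convolution-cong zero    f≗f′ g≗g′ = cong₂ _*_ (f≗f′ 0) (g≗g′ 0)
convolution-cong (suc k) f≗f′ g≗g′ =
  cong₂ _+_ (cong₂ _*_ (f≗f′ 0) (g≗g′ (suc k))) (convolution-cong k (f≗f′ ∘ suc) g≗g′)

convolution-zeroˡ : ∀ k g → convolution k (λ _ → 0) g ≡ 0
convolution-zeroˡ zero    g = refl
convolution-zeroˡ (suc k) g = convolution-zeroˡ k g

convolution-+ˡ : ∀ k f f′ g → convolution k (λ j → f j + f′ j) g ≡ convolution k f g + convolution k f′ g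
convolution-+ˡ zero    f f′ g = *-distribʳ-+ (g 0) (f 0) (f′ 0)
convolution-+ˡ (suc k) f f′ g = begin
  (f 0 + f′ 0) * g (suc k) + convolution k (λ j → f (suc j) + f′ (suc j)) g
    ≡⟨ cong₂ _+_ (*-distribʳ-+ (g (suc k)) (f 0) (f′ 0)) (convolution-+ˡ k (f ∘ suc) (f′ ∘ suc) g) ⟩
  (f 0 * g (suc k) + f′ 0 * g (suc k)) + (convolution k (f ∘ suc) g + convolution k (f′ ∘ suc) g)
    ≡⟨ +-interchange (f 0 * g (suc k)) _ (convolution k (f ∘ suc) g) _ ⟩
  (f 0 * g (suc k) + convolution k (f ∘ suc) g) + (f′ 0 * g (suc k) + convolution k (f′ ∘ suc) g)
    ∎
  where open ≡-Reasoning

convolution-+ʳ : ∀ k f g g′ → convolution k f (λ l → g l + g′ l) ≡ convolution k f g + convolution k f g′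
convolution-+ʳ zero    f g g′ = *-distribˡ-+ (f 0) (g 0) (g′ 0)
convolution-+ʳ (suc k) f g g′ = begin
  f 0 * (g (suc k) + g′ (suc k)) + convolution k (f ∘ suc) (λ l → g l + g′ l)
    ≡⟨ cong₂ _+_ (*-distribˡ-+ (f 0) (g (suc k)) (g′ (suc k))) (convolution-+ʳ k (f ∘ suc) g g′) ⟩
  (f 0 * g (suc k) + f 0 * g′ (suc k)) + (convolution k (f ∘ suc) g + convolution k (f ∘ suc) g′)
    ≡⟨ +-interchange (f 0 * g (suc k)) _ (convolution k (f ∘ suc) g) _ ⟩
  (f 0 * g (suc k) + convolution k (f ∘ suc) g) + (f 0 * g′ (suc k) + convolution k (f ∘ suc) g′)
    ∎
  where open ≡-Reasoning

convolution-delayʳ : ∀ k f g → convolution (suc k) f (delay g) ≡ convolution k f g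
convolution-delayʳ zero    f g = trans (cong (_+_ (f 0 * g 0)) (*-zeroʳ (f 1))) (+-identityʳ _)
convolution-delayʳ (suc k) f g = cong (_+_ (f 0 * g (suc k))) (convolution-delayʳ k (f ∘ suc) g)

C-suc : ∀ m j → suc m C j ≡ m C j + delay (m C_) j
C-suc m zero    = refl
C-suc m (suc j) = trans (sym (nCk+nC[k+1]≡[n+1]C[k+1] m j)) (+-comm (m C j) (m C suc j))

convolution-C-sucˡ : ∀ k m (φ g : ℕ → ℕ) →
                     convolution k (λ j → (m C j) * φ (suc j)) g + convolution (suc k) (λ j → (m C j) * φ j) g
                     ≡ convolution (suc k) (λ j → (suc m C j) * φ j) g
convolution-C-sucˡ k m φ g = begin
  convolution k h g + convolution (suc k) (λ j → (m C j) * φ j) g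
    ≡⟨ +-comm (convolution k h g) _ ⟩
  convolution (suc k) (λ j → (m C j) * φ j) g + convolution (suc k) (delay h) g
    ≡⟨ convolution-+ˡ (suc k) (λ j → (m C j) * φ j) (delay h) g ⟨
  convolution (suc k) (λ j → (m C j) * φ j + delay h j) g
    ≡⟨ convolution-cong (suc k) pascal (λ _ → refl) ⟨
  convolution (suc k) (λ j → (suc m C j) * φ j) g
    ∎
  where
  open ≡-Reasoning
  h : ℕ → ℕ
  h j = (m C j) * φ (suc j)
  pascal : ∀ j → (suc m C j) * φ j ≡ (m C j) * φ j + delay h j
  pascal zero    = sym (+-identityʳ (1 * φ 0))
  pascal (suc j) = trans (cong (_* φ (suc j)) (C-suc m (suc j))) (*-distribʳ-+ (φ (suc j)) (m C suc j) (m C j))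

convolution-C-sucʳ : ∀ k m (f : ℕ → ℕ) →
                     convolution k f (m C_) + convolution (suc k) f (m C_) ≡ convolution (suc k) f (suc m C_)
convolution-C-sucʳ k m f = begin
  convolution k f (m C_) + convolution (suc k) f (m C_)
    ≡⟨ +-comm (convolution k f (m C_)) _ ⟩
  convolution (suc k) f (m C_) + convolution k f (m C_)
    ≡⟨ cong (_+_ (convolution (suc k) f (m C_))) (convolution-delayʳ k f (m C_)) ⟨
  convolution (suc k) f (m C_) + convolution (suc k) f (delay (m C_))
    ≡⟨ convolution-+ʳ (suc k) f (m C_) (delay (m C_)) ⟨
  convolution (suc k) f (λ l → m C l + delay (m C_) l)
    ≡⟨ convolution-cong (suc k) {f} (λ _ → refl) (C-suc m) ⟨
  convolution (suc k) f (suc m C_)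
    ∎
  where open ≡-Reasoning

ΣIncreasing-count : ∀ n k (b : Fin n → Bool) (φ : ℕ → ℕ) →
                    ΣIncreasing k n (λ ι → φ (count k (b ∘ ι)))
                    ≡ convolution k (λ j → (count n b C j) * φ j) ((n ∸ count n b) C_)
ΣIncreasing-count n       zero    b φ = sym (*-identityʳ (1 * φ 0))
ΣIncreasing-count zero    (suc k) b φ =
  sym (cong₂ _+_ (*-zeroʳ (1 * φ 0)) (convolution-zeroˡ k (0 C_)))
ΣIncreasing-count (suc n) (suc k) b φ = begin
  ΣIncreasing (suc k) (suc n) (λ ι → φ (count (suc k) (b ∘ ι)))
    ≡⟨ ΣIncreasing-suc k n _ (λ ι≗κ → cong φ (ΣFin-cong (suc k) (cong (indicator ∘ b) ∘ ι≗κ))) ⟩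
  ΣIncreasing k n (λ ι → φ (indicator (b fzero) + count k (b′ ∘ ι)))
    + ΣIncreasing (suc k) n (λ ι → φ (count (suc k) (b′ ∘ ι)))
    ≡⟨ cong₂ _+_ (ΣIncreasing-count n k b′ (λ j → φ (indicator (b fzero) + j)))
                 (ΣIncreasing-count n (suc k) b′ φ) ⟩
  convolution k (λ j → (W C j) * φ (indicator (b fzero) + j)) ((n ∸ W) C_)
    + convolution (suc k) (λ j → (W C j) * φ j) ((n ∸ W) C_)
    ≡⟨ add-first (b fzero) ⟩
  convolution (suc k) (λ j → ((indicator (b fzero) + W) C j) * φ j) ((suc n ∸ (indicator (b fzero) + W)) C_)
    ∎
  where
  open ≡-Reasoning
  b′ : Fin n → Bool
  b′ = b ∘ fsuc
  W : ℕ
  W = count n b′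
  add-first : ∀ c → convolution k (λ j → (W C j) * φ (indicator c + j)) ((n ∸ W) C_)
                      + convolution (suc k) (λ j → (W C j) * φ j) ((n ∸ W) C_)
                    ≡ convolution (suc k) (λ j → ((indicator c + W) C j) * φ j) ((suc n ∸ (indicator c + W)) C_)
  add-first true  = convolution-C-sucˡ k W φ ((n ∸ W) C_)
  add-first false = trans (convolution-C-sucʳ k (n ∸ W) (λ j → (W C j) * φ j))
    (cong (λ m → convolution (suc k) (λ j → (W C j) * φ j) (m C_)) (sym (+-∸-assoc 1 (count≤ n b′))))

-- nonzeroSums p m z counts the (y₁, …, y_m) ∈ (F*)^m with s + y₁ + ⋯ + y_m ≠ 0,
-- where |F*| = p and z tells whether s = 0.
nonzeroSums : ℕ → ℕ → Bool → ℕ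
nonzeroSums p zero    z     = if z then 0 else 1
nonzeroSums p (suc m) true  = p * nonzeroSums p m false
nonzeroSums p (suc m) false = nonzeroSums p m true + (p ∸ 1) * nonzeroSums p m false

nonzeroSums-suc : ∀ p m z → nonzeroSums p (suc m) z
                  ≡ (if z then p * nonzeroSums p m false
                          else nonzeroSums p m true + (p ∸ 1) * nonzeroSums p m false)
nonzeroSums-suc p m true  = refl
nonzeroSums-suc p m false = refl

nonzeroSums-closedForm : ∀ r m → let p = suc r in
  (+ suc p ℤ.* + nonzeroSums p m true  ≡ + p ℤ.* ((+ p) ℤ.^ m ℤ.- (ℤ.- + 1) ℤ.^ m)) ×
  (+ suc p ℤ.* + nonzeroSums p m false ≡ (+ p) ℤ.^ suc m ℤ.+ (ℤ.- + 1) ℤ.^ m)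
nonzeroSums-closedForm r zero = base₀ (+ r) , base₁ (+ r)
  where
  base₀ : ∀ r → (+ 1 ℤ.+ (+ 1 ℤ.+ r)) ℤ.* + 0 ≡ (+ 1 ℤ.+ r) ℤ.* (+ 1 ℤ.- + 1)
  base₀ = solve-∀
  base₁ : ∀ r → (+ 1 ℤ.+ (+ 1 ℤ.+ r)) ℤ.* + 1 ≡ (+ 1 ℤ.+ r) ℤ.* + 1 ℤ.+ + 1
  base₁ = solve-∀
nonzeroSums-closedForm r (suc m) with nonzeroSums-closedForm r m
... | ih₀ , ih₁ = step₀ , step₁
  where
  open ≡-Reasoning
  p = suc r
  a = nonzeroSums p m true
  b = nonzeroSums p m false
  X = (+ p) ℤ.^ m
  E = (ℤ.- + 1) ℤ.^ m
  step₀ : + suc p ℤ.* + (p * b) ≡ + p ℤ.* ((+ p) ℤ.^ suc m ℤ.- (ℤ.- + 1) ℤ.^ suc m)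
  step₀ = begin
    + suc p ℤ.* + (p * b)          ≡⟨ cong (+ suc p ℤ.*_) (pos-* p b) ⟩
    + suc p ℤ.* (+ p ℤ.* + b)        ≡⟨ ℤ-x*[y*z]≡y*[x*z] (+ suc p) (+ p) (+ b) ⟩
    + p ℤ.* (+ suc p ℤ.* + b)        ≡⟨ cong (+ p ℤ.*_) ih₁ ⟩
    + p ℤ.* (+ p ℤ.* X ℤ.+ E)        ≡⟨ negate (+ p) X E ⟩
    + p ℤ.* (+ p ℤ.* X ℤ.- (ℤ.- + 1) ℤ.* E) ∎
    where
    negate : ∀ p X E → p ℤ.* (p ℤ.* X ℤ.+ E) ≡ p ℤ.* (p ℤ.* X ℤ.- (ℤ.- + 1) ℤ.* E)
    negate = solve-∀
  step₁ : + suc p ℤ.* + (a + r * b) ≡ (+ p) ℤ.^ suc (suc m) ℤ.+ (ℤ.- + 1) ℤ.^ suc m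
  step₁ = begin
    + suc p ℤ.* + (a + r * b)
      ≡⟨ cong (+ suc p ℤ.*_) (trans (pos-+ a (r * b)) (cong (ℤ._+_ (+ a)) (pos-* r b))) ⟩
    + suc p ℤ.* (+ a ℤ.+ + r ℤ.* + b)                    ≡⟨ distrib (+ suc p) (+ a) (+ r) (+ b) ⟩
    + suc p ℤ.* + a ℤ.+ + r ℤ.* (+ suc p ℤ.* + b)        ≡⟨ cong₂ (λ u v → u ℤ.+ + r ℤ.* v) ih₀ ih₁ ⟩
    + p ℤ.* (X ℤ.- E) ℤ.+ + r ℤ.* (+ p ℤ.* X ℤ.+ E)      ≡⟨ collect (+ r) X E ⟩
    + p ℤ.* (+ p ℤ.* X) ℤ.+ (ℤ.- + 1) ℤ.* E              ∎
    where
    distrib : ∀ q a r b → q ℤ.* (a ℤ.+ r ℤ.* b) ≡ q ℤ.* a ℤ.+ r ℤ.* (q ℤ.* b)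
    distrib = solve-∀
    collect : ∀ r X E → (+ 1 ℤ.+ r) ℤ.* (X ℤ.- E) ℤ.+ r ℤ.* ((+ 1 ℤ.+ r) ℤ.* X ℤ.+ E)
                        ≡ (+ 1 ℤ.+ r) ℤ.* ((+ 1 ℤ.+ r) ℤ.* X) ℤ.+ (ℤ.- + 1) ℤ.* E
    collect = solve-∀

Σℤ-cong : ∀ k {f g : ℕ → ℤ} → (∀ j → f j ≡ g j) → Σℤ k f ≡ Σℤ k g
Σℤ-cong zero    f≗g = f≗g 0
Σℤ-cong (suc k) f≗g = cong₂ ℤ._+_ (Σℤ-cong k f≗g) (f≗g (suc k))

Σℤ-*ˡ : ∀ k c (f : ℕ → ℤ) → Σℤ k (λ j → c ℤ.* f j) ≡ c ℤ.* Σℤ k f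
Σℤ-*ˡ zero    c f = refl
Σℤ-*ˡ (suc k) c f = trans (cong (ℤ._+ c ℤ.* f (suc k)) (Σℤ-*ˡ k c f)) (sym (ℤₚ.*-distribˡ-+ c (Σℤ k f) (f (suc k))))

Σℤ-suc : ∀ k (f : ℕ → ℤ) → Σℤ (suc k) f ≡ f 0 ℤ.+ Σℤ k (f ∘ suc)
Σℤ-suc zero    f = refl
Σℤ-suc (suc k) f = trans (cong (ℤ._+ f (suc (suc k))) (Σℤ-suc k f)) (ℤₚ.+-assoc (f 0) (Σℤ k (f ∘ suc)) (f (suc (suc k))))

convolution≡Σℤ : ∀ k f g → + convolution k f g ≡ Σℤ k (λ j → + (f j * g (k ∸ j)))
convolution≡Σℤ zero    f g = refl
convolution≡Σℤ (suc k) f g = begin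
  + (f 0 * g (suc k) + convolution k (f ∘ suc) g)             ≡⟨ pos-+ (f 0 * g (suc k)) _ ⟩
  + (f 0 * g (suc k)) ℤ.+ + convolution k (f ∘ suc) g
    ≡⟨ cong (ℤ._+_ (+ (f 0 * g (suc k)))) (convolution≡Σℤ k (f ∘ suc) g) ⟩
  + (f 0 * g (suc k)) ℤ.+ Σℤ k (λ j → + (f (suc j) * g (k ∸ j))) ≡⟨ Σℤ-suc k (λ j → + (f j * g (suc k ∸ j))) ⟨
  Σℤ (suc k) (λ j → + (f j * g (suc k ∸ j)))                    ∎
  where open ≡-Reasoning

toℚᵘ-/ : ∀ i d → toℚᵘ (i / suc d) ≃ mkℚᵘ i d
toℚᵘ-/ i d = toℚᵘ-fromℚᵘ (mkℚᵘ i d)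

ℤ-identity⇒ℚᵘ-identity : ∀ q′ (L M p : ℕ) (S : ℤ) → + suc q′ ℤ.* + L ≡ + M ℤ.* (+ p ℤ.* S) →
                         mkℚᵘ (+ L) 0
                         ≃ (mkℚᵘ (+ (2 * p)) q′ ℚᵘ.* mkℚᵘ (+ M) 0) ℚᵘ.* (mkℚᵘ (+ 1) 1 ℚᵘ.* mkℚᵘ S 0)
ℤ-identity⇒ℚᵘ-identity q′ L M p S qL≡MpS = *≡* (begin
    + L ℤ.* (+ suc (suc (q′ * 1 * 2)))  ≡⟨ cong (λ x → + L ℤ.* + suc (suc (x * 2))) (*-identityʳ q′) ⟩
    + L ℤ.* (+ suc q′ ℤ.* + 2)              ≡⟨ rearrangeˡ (+ L) (+ suc q′) ⟩
    + 2 ℤ.* (+ suc q′ ℤ.* + L)              ≡⟨ cong (+ 2 ℤ.*_) qL≡MpS ⟩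
    + 2 ℤ.* (+ M ℤ.* (+ p ℤ.* S))           ≡⟨ rearrangeʳ (+ M) (+ p) S ⟩
    ((+ 2 ℤ.* + p) ℤ.* + M) ℤ.* (+ 1 ℤ.* S) ℤ.* + 1
      ≡⟨ cong (λ x → (x ℤ.* + M) ℤ.* (+ 1 ℤ.* S) ℤ.* + 1) (pos-* 2 p) ⟨
    (+ (2 * p) ℤ.* + M) ℤ.* (+ 1 ℤ.* S) ℤ.* + 1 ∎)
  where
  open ≡-Reasoning
  rearrangeˡ : ∀ L q → L ℤ.* (q ℤ.* + 2) ≡ + 2 ℤ.* (q ℤ.* L)
  rearrangeˡ = solve-∀
  rearrangeʳ : ∀ M p S → + 2 ℤ.* (M ℤ.* (p ℤ.* S)) ≡ ((+ 2 ℤ.* p) ℤ.* M) ℤ.* (+ 1 ℤ.* S) ℤ.* + 1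
  rearrangeʳ = solve-∀

ℤ-identity⇒ℚ-identity : ∀ q .{{_ : ℕ.NonZero q}} (L M p : ℕ) (S : ℤ) →
                        + q ℤ.* + L ≡ + M ℤ.* (+ p ℤ.* S) →
                        + L / 1 ≡ (+ (2 * p) / q) ℚ.* (+ M / 1) ℚ.* (½ ℚ.* (S / 1))
ℤ-identity⇒ℚ-identity (suc q′) L M p S qL≡MpS = toℚᵘ-injective (begin
  toℚᵘ (+ L / 1)                                              ≈⟨ toℚᵘ-/ (+ L) 0 ⟩
  mkℚᵘ (+ L) 0                                                ≈⟨ ℤ-identity⇒ℚᵘ-identity q′ L M p S qL≡MpS ⟩
  (mkℚᵘ (+ (2 * p)) q′ ℚᵘ.* mkℚᵘ (+ M) 0) ℚᵘ.* (mkℚᵘ (+ 1) 1 ℚᵘ.* mkℚᵘ S 0)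
    ≈⟨ *-cong (*-cong (toℚᵘ-/ (+ (2 * p)) q′) (toℚᵘ-/ (+ M) 0)) (*-cong (toℚᵘ-/ (+ 1) 1) (toℚᵘ-/ S 0)) ⟨
  (toℚᵘ a ℚᵘ.* toℚᵘ b) ℚᵘ.* (toℚᵘ ½ ℚᵘ.* toℚᵘ c)
    ≈⟨ *-cong (toℚᵘ-homo-* a b) (toℚᵘ-homo-* ½ c) ⟨
  toℚᵘ (a ℚ.* b) ℚᵘ.* toℚᵘ (½ ℚ.* c)                         ≈⟨ toℚᵘ-homo-* (a ℚ.* b) (½ ℚ.* c) ⟨
  toℚᵘ (a ℚ.* b ℚ.* (½ ℚ.* c))                                ∎)
  where
  open ≃-Reasoning
  a = + (2 * p) / suc q′
  b = + M / 1
  c = S / 1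

module _ (F : FiniteField) where
  open FiniteField F using (Carrier; _≈_; 0#; 1#; _≟_; ω; q; ω-inj; ω-surj; inverse)
    renaming (_+_ to _+F_; _*_ to _*F_; -_ to -F_)
  private module F = FiniteField F

  isZero : Carrier → Bool
  isZero a = does (a ≟ 0#)

  isZero-elim : ∀ {ℓ} (P : Bool → Set ℓ) a → (a ≈ 0# → P true) → (¬ a ≈ 0# → P false) → P (isZero a)
  isZero-elim P a onZero onNonzero with a ≟ 0#
  ... | yes a≈0 = onZero a≈0
  ... | no  a≉0 = onNonzero a≉0

  T-isZero⁻ : ∀ {a} → T (isZero a) → a ≈ 0#
  T-isZero⁻ {a} = T-does⁻ (a ≟ 0#)

  T-isZero⁺ : ∀ {a} → a ≈ 0# → T (isZero a)
  T-isZero⁺ {a} = T-does⁺ (a ≟ 0#)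

  isZero-cong : ∀ {a b} → a ≈ b → isZero a ≡ isZero b
  isZero-cong a≈b = ≡-by-T (λ a≈0 → T-isZero⁺ (F.trans (F.sym a≈b) (T-isZero⁻ a≈0)))
                           (λ b≈0 → T-isZero⁺ (F.trans a≈b (T-isZero⁻ b≈0)))

  nz≡indicator : ∀ a → nz F a ≡ indicator (not (isZero a))
  nz≡indicator a = lemma (isZero a)
    where
    lemma : ∀ z → (if z then 0 else 1) ≡ indicator (not z)
    lemma true  = refl
    lemma false = refl

  nz≡ᵇ1 : ∀ a → (nz F a ℕ.≡ᵇ 1) ≡ not (isZero a)
  nz≡ᵇ1 a = lemma (isZero a)
    where
    lemma : ∀ z → ((if z then 0 else 1) ℕ.≡ᵇ 1) ≡ not z
    lemma true  = refl
    lemma false = refl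

  nz-cong : ∀ {a b} → a ≈ b → nz F a ≡ nz F b
  nz-cong a≈b = cong (λ z → if z then 0 else 1) (isZero-cong a≈b)

  wt≡count : ∀ {k} (v : Fin k → Carrier) → wt F v ≡ count k (λ t → not (isZero (v t)))
  wt≡count {k} v = ΣFin-cong k (nz≡indicator ∘ v)

  wt≤ : ∀ {k} (v : Fin k → Carrier) → wt F v ℕ.≤ k
  wt≤ {k} v = ≤-trans (≤-reflexive (wt≡count v)) (count≤ k (λ t → not (isZero (v t))))

  p : ℕ
  p = q ∸ 1

  q≡2+ : ∃ λ r → q ≡ suc (suc r)
  q≡2+ = two-distinct⇒≥2 {i = proj₁ (ω-surj 0#)} {j = proj₁ (ω-surj 1#)} λ i₀≡i₁ →
    F.0≉1 (F.trans (F.sym (proj₂ (ω-surj 0#)))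
                   (F.trans (F.reflexive (cong ω i₀≡i₁)) (proj₂ (ω-surj 1#))))

  count-nonzero : count q (λ c → not (isZero (ω c))) ≡ p
  count-nonzero = cong (_∸ 1) (begin
    1 + count q (λ c → not (isZero (ω c)))
      ≡⟨ cong (_+ count q (λ c → not (isZero (ω c)))) count-zero ⟨
    count q (isZero ∘ ω) + count q (λ c → not (isZero (ω c)))
      ≡⟨ count-∧-split q (λ _ → true) (isZero ∘ ω) ⟩
    ΣFin q (λ _ → 1)
      ≡⟨ ΣFin-const q 1 ⟩
    q * 1
      ≡⟨ *-identityʳ q ⟩
    q ∎)
    where
    open ≡-Reasoning
    c₀ = proj₁ (ω-surj 0#)
    count-zero : count q (isZero ∘ ω) ≡ 1
    count-zero = count-unique q c₀ (T-isZero⁺ (proj₂ (ω-surj 0#)))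
      (λ c ωc≈0 → ω-inj c c₀ (F.trans (T-isZero⁻ ωc≈0) (F.sym (proj₂ (ω-surj 0#)))))

  x*v≈u⇒x≈u*w : ∀ {v w x u} → v *F w ≈ 1# → x *F v ≈ u → x ≈ u *F w
  x*v≈u⇒x≈u*w {v} {w} {x} {u} vw≈1 xv≈u = begin
    x               ≈⟨ F.*-identityʳ x ⟨
    x *F 1#         ≈⟨ F.*-congˡ vw≈1 ⟨
    x *F (v *F w)   ≈⟨ F.*-assoc x v w ⟨
    (x *F v) *F w   ≈⟨ F.*-congʳ xv≈u ⟩
    u *F w          ∎
    where open import Relation.Binary.Reasoning.Setoid F.setoid

  count-roots : ∀ {v} → ¬ v ≈ 0# → ∀ s →
                count q (λ c → not (isZero (ω c)) ∧ isZero (s +F ω c *F v)) ≡ indicator (not (isZero s))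
  count-roots {v} v≉0 s = isZero-elim (λ z → count q root ≡ indicator (not z)) s no-root one-root
    where
    open import Relation.Binary.Reasoning.Setoid F.setoid
    open import Algebra.Properties.AbelianGroup F.+-abelianGroup using (inverseʳ-unique; ε⁻¹≈ε)
    w = proj₁ (inverse v v≉0)
    vw≈1 = proj₂ (inverse v v≉0)
    root : Fin q → Bool
    root c = not (isZero (ω c)) ∧ isZero (s +F ω c *F v)
    solve : ∀ {x} → s +F x *F v ≈ 0# → x ≈ -F s *F w
    solve s+xv≈0 = x*v≈u⇒x≈u*w vw≈1 (inverseʳ-unique s _ s+xv≈0)
    no-root : s ≈ 0# → count q root ≡ 0
    no-root s≈0 = count-none q λ c rc →
      let ωc≉0 , s+ωcv≈0 = Equivalence.to T-∧ rc in
      T-not⁻ ωc≉0 (T-isZero⁺ (begin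
        ω c            ≈⟨ solve (T-isZero⁻ s+ωcv≈0) ⟩
        -F s *F w      ≈⟨ F.*-congʳ (F.-‿cong s≈0) ⟩
        -F 0# *F w     ≈⟨ F.*-congʳ ε⁻¹≈ε ⟩
        0# *F w        ≈⟨ F.zeroˡ w ⟩
        0#             ∎))
    s+[-s*w]*v≈0 : s +F (-F s *F w) *F v ≈ 0#
    s+[-s*w]*v≈0 = begin
      s +F (-F s *F w) *F v     ≈⟨ F.+-congˡ (F.*-assoc (-F s) w v) ⟩
      s +F -F s *F (w *F v)     ≈⟨ F.+-congˡ (F.*-congˡ (F.trans (F.*-comm w v) vw≈1)) ⟩
      s +F -F s *F 1#           ≈⟨ F.+-congˡ (F.*-identityʳ (-F s)) ⟩
      s +F -F s                 ≈⟨ F.-‿inverseʳ s ⟩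
      0#                        ∎
    one-root : ¬ s ≈ 0# → count q root ≡ 1
    one-root s≉0 = count-unique q c₀ (Equivalence.from T-∧ (T-not⁺ ωc₀≉0 , T-isZero⁺ s+ωc₀v≈0))
      (λ c rc → ω-inj c c₀ (F.trans (solve (T-isZero⁻ (proj₂ (Equivalence.to T-∧ rc)))) (F.sym ωc₀≈)))
      where
      c₀ = proj₁ (ω-surj (-F s *F w))
      ωc₀≈ = proj₂ (ω-surj (-F s *F w))
      s+ωc₀v≈0 : s +F ω c₀ *F v ≈ 0#
      s+ωc₀v≈0 = F.trans (F.+-congˡ (F.*-congʳ ωc₀≈)) s+[-s*w]*v≈0
      ωc₀≉0 : ¬ T (isZero (ω c₀))
      ωc₀≉0 ωc₀≈0 = s≉0 (begin
        s                 ≈⟨ F.+-identityʳ s ⟨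
        s +F 0#           ≈⟨ F.+-congˡ (F.zeroˡ v) ⟨
        s +F 0# *F v      ≈⟨ F.+-congˡ (F.*-congʳ (T-isZero⁻ ωc₀≈0)) ⟨
        s +F ω c₀ *F v    ≈⟨ s+ωc₀v≈0 ⟩
        0#                ∎)

  Σnonzero-shift : ∀ {v} → ¬ v ≈ 0# → ∀ s (g : Bool → ℕ) →
                   ΣFin q (λ c → indicator (not (isZero (ω c))) * g (isZero (s +F ω c *F v)))
                   ≡ (if isZero s then p * g false else g true + (p ∸ 1) * g false)
  Σnonzero-shift {v} v≉0 s g =
    trans (ΣFin-indicator-split q (λ c → not (isZero (ω c))) (λ c → isZero (s +F ω c *F v)) g)
            (combine (isZero s) (count-roots v≉0 s)
                     (trans (count-∧-split q _ (λ c → isZero (s +F ω c *F v))) count-nonzero))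
    where
    combine : ∀ z {h m n} → h ≡ indicator (not z) → h + m ≡ n →
              g true * h + g false * m ≡ (if z then n * g false else g true + (n ∸ 1) * g false)
    combine true  {m = m} refl refl = trans (cong (_+ g false * m) (*-zeroʳ (g true))) (*-comm (g false) m)
    combine false {m = m} refl refl = cong₂ _+_ (*-identityʳ (g true)) (*-comm (g false) m)

  nonvanishing : ∀ k → (Fin k → Carrier) → Carrier → ℕ
  nonvanishing k v s = ΣFun k q (λ β → indicator (allNonzero F β) * nz F (s +F ΣF F k (λ t → ω (β t) *F v t)))

  nonvanishing-cong : ∀ k v {s s′} → s ≈ s′ → nonvanishing k v s ≡ nonvanishing k v s′
  nonvanishing-cong k v s≈s′ = ΣFun-cong k q (λ β → cong (indicator (allNonzero F β) *_) (nz-cong (F.+-congʳ s≈s′)))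

  nonvanishing-suc : ∀ k v s → nonvanishing (suc k) v s
                     ≡ ΣFin q (λ c → indicator (not (isZero (ω c))) * nonvanishing k (v ∘ fsuc) (s +F ω c *F v fzero))
  nonvanishing-suc k v s = ΣFin-cong q λ c →
    trans (ΣFun-cong k q (λ β → split c β (ω c *F v fzero) _)) (ΣFun-*ˡ k q (indicator (not (isZero (ω c)))) _)
    where
    split : ∀ c β a b → indicator ((nz F (ω c) ℕ.≡ᵇ 1) ∧ allNonzero F β) * nz F (s +F (a +F b))
                        ≡ indicator (not (isZero (ω c))) * (indicator (allNonzero F β) * nz F ((s +F a) +F b))
    split c β a b = begin
      indicator ((nz F (ω c) ℕ.≡ᵇ 1) ∧ allNonzero F β) * nz F (s +F (a +F b))
        ≡⟨ cong (_* nz F (s +F (a +F b))) (indicator-∧ (nz F (ω c) ℕ.≡ᵇ 1) (allNonzero F β)) ⟩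
      indicator (nz F (ω c) ℕ.≡ᵇ 1) * indicator (allNonzero F β) * nz F (s +F (a +F b))
        ≡⟨ cong₂ (λ z u → indicator z * indicator (allNonzero F β) * u)
                 (nz≡ᵇ1 (ω c)) (nz-cong (F.sym (F.+-assoc s a b))) ⟩
      indicator (not (isZero (ω c))) * indicator (allNonzero F β) * nz F ((s +F a) +F b)
        ≡⟨ *-assoc (indicator (not (isZero (ω c)))) _ _ ⟩
      indicator (not (isZero (ω c))) * (indicator (allNonzero F β) * nz F ((s +F a) +F b))
        ∎
      where open ≡-Reasoning

  nonvanishing≡nonzeroSums : ∀ k v s → nonvanishing k v s ≡ p ^ (k ∸ wt F v) * nonzeroSums p (wt F v) (isZero s)
  nonvanishing≡nonzeroSums zero    v s = cong (1 *_) (nz-cong (F.+-identityʳ s))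
  nonvanishing≡nonzeroSums (suc k) v s with v fzero ≟ 0#
  ... | yes v₀≈0 = begin
    nonvanishing (suc k) v s
      ≡⟨ nonvanishing-suc k v s ⟩
    ΣFin q (λ c → indicator (not (isZero (ω c))) * nonvanishing k v′ (s +F ω c *F v fzero))
      ≡⟨ ΣFin-cong q (λ c → cong (indicator (not (isZero (ω c))) *_)
                                 (trans (nonvanishing-cong k v′ (s+c*v₀≈s c)) (nonvanishing≡nonzeroSums k v′ s))) ⟩
    ΣFin q (λ c → indicator (not (isZero (ω c))) * (p ^ (k ∸ m) * N))
      ≡⟨ ΣFin-indicator-*ʳ q (λ c → not (isZero (ω c))) _ ⟩
    count q (λ c → not (isZero (ω c))) * (p ^ (k ∸ m) * N)
      ≡⟨ cong (_* (p ^ (k ∸ m) * N)) count-nonzero ⟩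
    p * (p ^ (k ∸ m) * N)
      ≡⟨ *-assoc p (p ^ (k ∸ m)) N ⟨
    p ^ suc (k ∸ m) * N
      ≡⟨ cong (λ e → p ^ e * N) (+-∸-assoc 1 (wt≤ v′)) ⟨
    p ^ (suc k ∸ m) * N
      ∎
    where
    open ≡-Reasoning
    v′ = v ∘ fsuc
    m = wt F v′
    N = nonzeroSums p m (isZero s)
    s+c*v₀≈s : ∀ c → s +F ω c *F v fzero ≈ s
    s+c*v₀≈s c = F.trans (F.+-congˡ (F.trans (F.*-congˡ v₀≈0) (F.zeroʳ (ω c)))) (F.+-identityʳ s)
  ... | no v₀≉0 = begin
    nonvanishing (suc k) v s
      ≡⟨ nonvanishing-suc k v s ⟩
    ΣFin q (λ c → indicator (not (isZero (ω c))) * nonvanishing k v′ (s +F ω c *F v fzero))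
      ≡⟨ ΣFin-cong q (λ c → trans (cong (indicator (not (isZero (ω c))) *_) (nonvanishing≡nonzeroSums k v′ _))
                                     (x*[y*z]≡y*[x*z] (indicator (not (isZero (ω c)))) (p ^ (k ∸ m)) _)) ⟩
    ΣFin q (λ c → p ^ (k ∸ m) * (indicator (not (isZero (ω c))) * nonzeroSums p m (isZero (s +F ω c *F v fzero))))
      ≡⟨ ΣFin-*ˡ q (p ^ (k ∸ m)) _ ⟩
    p ^ (k ∸ m) * ΣFin q (λ c → indicator (not (isZero (ω c))) * nonzeroSums p m (isZero (s +F ω c *F v fzero)))
      ≡⟨ cong (p ^ (k ∸ m) *_) (trans (Σnonzero-shift v₀≉0 s (nonzeroSums p m)) (sym (nonzeroSums-suc p m (isZero s)))) ⟩
    p ^ (k ∸ m) * nonzeroSums p (suc m) (isZero s)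
      ∎
    where
    open ≡-Reasoning
    v′ = v ∘ fsuc
    m = wt F v′

  isFirst : Fin q → Bool
  isFirst c = does (toℕ c ℕ.≟ 0)

  isFirst⁻ : ∀ {c} → T (isFirst c) → ω c ≈ 0#
  isFirst⁻ {c} first = F.ω₁≈0 c (T-does⁻ (toℕ c ℕ.≟ 0) first)

  isFirst⁺ : ∀ {c} → ω c ≈ 0# → T (isFirst c)
  isFirst⁺ {c} ωc≈0 = T-does⁺ (toℕ c ℕ.≟ 0) (subst (λ i → toℕ i ≡ 0) (sym c≡c₀) c₀≡0)
    where
    c₀ = proj₁ (∃toℕ≡0 c)
    c₀≡0 = proj₂ (∃toℕ≡0 c)
    c≡c₀ : c ≡ c₀
    c≡c₀ = ω-inj c c₀ (F.trans ωc≈0 (F.sym (F.ω₁≈0 c₀ c₀≡0)))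

  count-preimage : ∀ a → count q (λ c → not (isFirst c) ∧ does (a ≟ ω c)) ≡ nz F a
  count-preimage a = isZero-elim (λ z → count q hit ≡ (if z then 0 else 1)) a none unique
    where
    hit : Fin q → Bool
    hit c = not (isFirst c) ∧ does (a ≟ ω c)
    none : a ≈ 0# → count q hit ≡ 0
    none a≈0 = count-none q λ c hitc →
      let notFirst , a≈ωc = Equivalence.to T-∧ hitc in
      T-not⁻ notFirst (isFirst⁺ (F.trans (F.sym (T-does⁻ (a ≟ ω c) a≈ωc)) a≈0))
    unique : ¬ a ≈ 0# → count q hit ≡ 1
    unique a≉0 = count-unique q c₁
      (Equivalence.from T-∧ (T-not⁺ (a≉0 ∘ a≈0) , T-does⁺ (a ≟ ω c₁) (F.sym ωc₁≈a)))
      (λ c hitc → ω-inj c c₁ (F.trans (F.sym (T-does⁻ (a ≟ ω c) (proj₂ (Equivalence.to T-∧ hitc)))) (F.sym ωc₁≈a)))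
      where
      c₁ = proj₁ (ω-surj a)
      ωc₁≈a = proj₂ (ω-surj a)
      a≈0 : T (isFirst c₁) → a ≈ 0#
      a≈0 first = F.trans (F.sym ωc₁≈a) (isFirst⁻ first)

  Σx≡wt : ∀ {M} (a : Fin M → Carrier) → Σx F a ≡ wt F a
  Σx≡wt {M} a = begin
    ΣFin q (λ c → if isFirst c then 0 else x F c a)
      ≡⟨ ΣFin-cong q (λ c → if-first c) ⟩
    ΣFin q (λ c → ΣFin M (λ j → indicator (not (isFirst c)) * indicator (does (a j ≟ ω c))))
      ≡⟨ ΣFin-comm q M _ ⟩
    ΣFin M (λ j → ΣFin q (λ c → indicator (not (isFirst c)) * indicator (does (a j ≟ ω c))))
      ≡⟨ ΣFin-cong M (λ j → trans (ΣFin-cong q (λ c → sym (indicator-∧ (not (isFirst c)) _))) (count-preimage (a j))) ⟩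
    wt F a
      ∎
    where
    open ≡-Reasoning
    if-first : ∀ c → (if isFirst c then 0 else x F c a)
               ≡ ΣFin M (λ j → indicator (not (isFirst c)) * indicator (does (a j ≟ ω c)))
    if-first c = begin
      (if isFirst c then 0 else x F c a)                                   ≡⟨ if-0≡indicator-not* (isFirst c) _ ⟩
      indicator (not (isFirst c)) * x F c a                                ≡⟨ ΣFin-*ˡ M (indicator (not (isFirst c))) _ ⟨
      ΣFin M (λ j → indicator (not (isFirst c)) * (if does (a j ≟ ω c) then 1 else 0))
        ≡⟨ ΣFin-cong M (λ j → cong (indicator (not (isFirst c)) *_) (if-1-0≡indicator (does (a j ≟ ω c)))) ⟩
      ΣFin M (λ j → indicator (not (isFirst c)) * indicator (does (a j ≟ ω c))) ∎

  rowContribution : (k n w : ℕ) → ℕ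
  rowContribution k n w = convolution k (λ j → (w C j) * (p ^ (k ∸ j) * nonzeroSums p j true)) ((n ∸ w) C_)

  module _ {M n w : ℕ} (𝒞 : ConstantWeightCode F M n w) (k : ℕ) where
    open ConstantWeightCode 𝒞

    LHS-summand : (Fin k → Fin q) → (Fin k → Fin n) → Fin M → ℕ
    LHS-summand β ι j = indicator (allNonzero F β) * (indicator (isStrictlyIncreasing ι) * nz F (lincomb F 𝒞 (ω ∘ β) ι j))

    LHS≡ΣLHS-summand : LHS F 𝒞 k ≡ ΣFin M (λ j → ΣFun k n (λ ι → ΣFun k q (λ β → LHS-summand β ι j)))
    LHS≡ΣLHS-summand = begin
      LHS F 𝒞 k
        ≡⟨ ΣFun-cong k q outer ⟩
      ΣFun k q (λ β → ΣFun k n (λ ι → ΣFin M (LHS-summand β ι)))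
        ≡⟨ ΣFun-cong k q (λ β → ΣFun-ΣFin k n M (LHS-summand β)) ⟩
      ΣFun k q (λ β → ΣFin M (λ j → ΣFun k n (λ ι → LHS-summand β ι j)))
        ≡⟨ ΣFun-ΣFin k q M _ ⟩
      ΣFin M (λ j → ΣFun k q (λ β → ΣFun k n (λ ι → LHS-summand β ι j)))
        ≡⟨ ΣFin-cong M (λ j → ΣFun-comm k q k n (λ β ι → LHS-summand β ι j)) ⟩
      ΣFin M (λ j → ΣFun k n (λ ι → ΣFun k q (λ β → LHS-summand β ι j)))
        ∎
      where
      open ≡-Reasoning
      increasingTerm : (Fin k → Fin q) → (Fin k → Fin n) → ℕ
      increasingTerm β ι = if isStrictlyIncreasing ι then Σx F (lincomb F 𝒞 (ω ∘ β) ι) else 0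
      rowTerm : (Fin k → Fin q) → (Fin k → Fin n) → Fin M → ℕ
      rowTerm β ι j = indicator (isStrictlyIncreasing ι) * nz F (lincomb F 𝒞 (ω ∘ β) ι j)
      inner : ∀ β ι → increasingTerm β ι ≡ ΣFin M (rowTerm β ι)
      inner β ι = begin
        increasingTerm β ι
          ≡⟨ if≡indicator* (isStrictlyIncreasing ι) _ ⟩
        indicator (isStrictlyIncreasing ι) * Σx F (lincomb F 𝒞 (ω ∘ β) ι)
          ≡⟨ cong (indicator (isStrictlyIncreasing ι) *_) (Σx≡wt (lincomb F 𝒞 (ω ∘ β) ι)) ⟩
        indicator (isStrictlyIncreasing ι) * wt F (lincomb F 𝒞 (ω ∘ β) ι)
          ≡⟨ ΣFin-*ˡ M (indicator (isStrictlyIncreasing ι)) _ ⟨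
        ΣFin M (rowTerm β ι)
          ∎
      outer : ∀ β → (if allNonzero F β then ΣFun k n (increasingTerm β) else 0)
                    ≡ ΣFun k n (λ ι → ΣFin M (LHS-summand β ι))
      outer β = begin
        (if allNonzero F β then ΣFun k n (increasingTerm β) else 0)
          ≡⟨ if≡indicator* (allNonzero F β) _ ⟩
        indicator (allNonzero F β) * ΣFun k n (increasingTerm β)
          ≡⟨ cong (indicator (allNonzero F β) *_) (ΣFun-cong k n (inner β)) ⟩
        indicator (allNonzero F β) * ΣFun k n (λ ι → ΣFin M (rowTerm β ι))
          ≡⟨ ΣFun-*ˡ k n (indicator (allNonzero F β)) _ ⟨
        ΣFun k n (λ ι → indicator (allNonzero F β) * ΣFin M (rowTerm β ι))
          ≡⟨ ΣFun-cong k n (λ ι → ΣFin-*ˡ M (indicator (allNonzero F β)) (rowTerm β ι)) ⟨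
        ΣFun k n (λ ι → ΣFin M (LHS-summand β ι))
          ∎

    LHS-row≡rowContribution : ∀ j → ΣFun k n (λ ι → ΣFun k q (λ β → LHS-summand β ι j)) ≡ rowContribution k n w
    LHS-row≡rowContribution j = begin
      ΣFun k n (λ ι → ΣFun k q (λ β → LHS-summand β ι j))
        ≡⟨ ΣFun-cong k n (λ ι → pull-increasing ι) ⟩
      ΣIncreasing k n (λ ι → nonvanishing k (row j ∘ ι) 0#)
        ≡⟨ ΣFun-cong k n (λ ι → cong (indicator (isStrictlyIncreasing ι) *_) (by-support ι)) ⟩
      ΣIncreasing k n (λ ι → φ (count k (support ∘ ι)))
        ≡⟨ ΣIncreasing-count n k support φ ⟩
      convolution k (λ i → (count n support C i) * φ i) ((n ∸ count n support) C_)
        ≡⟨ cong (λ W → convolution k (λ i → (W C i) * φ i) ((n ∸ W) C_)) (trans (sym (wt≡count (row j))) (weight j)) ⟩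
      rowContribution k n w
        ∎
      where
      open ≡-Reasoning
      support : Fin n → Bool
      support l = not (isZero (row j l))
      φ : ℕ → ℕ
      φ m = p ^ (k ∸ m) * nonzeroSums p m true
      pull-increasing : ∀ ι → ΣFun k q (λ β → LHS-summand β ι j)
                              ≡ indicator (isStrictlyIncreasing ι) * nonvanishing k (row j ∘ ι) 0#
      pull-increasing ι = trans
        (ΣFun-cong k q (λ β → trans (x*[y*z]≡y*[x*z] (indicator (allNonzero F β)) (indicator (isStrictlyIncreasing ι)) _)
          (cong (λ u → indicator (isStrictlyIncreasing ι) * (indicator (allNonzero F β) * u)) (nz-cong (F.sym (F.+-identityˡ _))))))
        (ΣFun-*ˡ k q (indicator (isStrictlyIncreasing ι)) _)
      by-support : ∀ ι → nonvanishing k (row j ∘ ι) 0# ≡ φ (count k (support ∘ ι))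
      by-support ι = trans (nonvanishing≡nonzeroSums k (row j ∘ ι) 0#)
        (cong₂ (λ m z → p ^ (k ∸ m) * nonzeroSums p m z) (wt≡count (row j ∘ ι)) (≡-by-T _ (λ _ → T-isZero⁺ F.refl)))

    LHS≡M*rowContribution : LHS F 𝒞 k ≡ M * rowContribution k n w
    LHS≡M*rowContribution = trans LHS≡ΣLHS-summand (trans (ΣFin-cong M LHS-row≡rowContribution) (ΣFin-const M _))

  q*nonzeroSums : ∀ m → + q ℤ.* + nonzeroSums p m true ≡ + p ℤ.* ((+ p) ℤ.^ m ℤ.- (ℤ.- + 1) ℤ.^ m)
  q*nonzeroSums m with q≡2+
  ... | r , q≡2+r = subst₂ (λ a b → + a ℤ.* + nonzeroSums b m true ≡ + b ℤ.* ((+ b) ℤ.^ m ℤ.- (ℤ.- + 1) ℤ.^ m))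
                             (sym q≡2+r) (sym (cong (_∸ 1) q≡2+r)) (proj₁ (nonzeroSums-closedForm r m))

  -- the summand of Pminus, which is local to its where-block; the two agree definitionally
  Pminus-summand : (k n w : ℕ) → ℕ → ℤ
  Pminus-summand k n w j =
    ((+ p) ℤ.^ j ℤ.- (ℤ.- (+ 1)) ℤ.^ j) ℤ.* (+ (p ^ (k ∸ j))) ℤ.* (+ (w C j)) ℤ.* (+ ((n ∸ w) C (k ∸ j)))

  q*rowContribution : ∀ k n w → + q ℤ.* + rowContribution k n w ≡ + p ℤ.* Σℤ k (Pminus-summand k n w)
  q*rowContribution k n w = begin
    + q ℤ.* + rowContribution k n w
      ≡⟨ cong (+ q ℤ.*_) (convolution≡Σℤ k _ _) ⟩
    + q ℤ.* Σℤ k (λ j → + ((w C j) * (p ^ (k ∸ j) * nonzeroSums p j true) * ((n ∸ w) C (k ∸ j))))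
      ≡⟨ Σℤ-*ˡ k (+ q) _ ⟨
    Σℤ k (λ j → + q ℤ.* + ((w C j) * (p ^ (k ∸ j) * nonzeroSums p j true) * ((n ∸ w) C (k ∸ j))))
      ≡⟨ Σℤ-cong k termwise ⟩
    Σℤ k (λ j → + p ℤ.* Pminus-summand k n w j)
      ≡⟨ Σℤ-*ˡ k (+ p) _ ⟩
    + p ℤ.* Σℤ k (Pminus-summand k n w)
      ∎
    where
    open ≡-Reasoning
    termwise : ∀ j → + q ℤ.* + ((w C j) * (p ^ (k ∸ j) * nonzeroSums p j true) * ((n ∸ w) C (k ∸ j)))
                     ≡ + p ℤ.* Pminus-summand k n w j
    termwise j = begin
      + q ℤ.* + (A * (B * N) * D)
        ≡⟨ cong (+ q ℤ.*_) (trans (pos-* (A * (B * N)) D)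
                                  (cong (ℤ._* + D) (trans (pos-* A (B * N)) (cong (ℤ._*_ (+ A)) (pos-* B N))))) ⟩
      + q ℤ.* (+ A ℤ.* (+ B ℤ.* + N) ℤ.* + D)
        ≡⟨ regroup (+ q) (+ A) (+ B) (+ N) (+ D) ⟩
      (+ q ℤ.* + N) ℤ.* (+ A ℤ.* + B ℤ.* + D)
        ≡⟨ cong (ℤ._* (+ A ℤ.* + B ℤ.* + D)) (q*nonzeroSums j) ⟩
      (+ p ℤ.* X) ℤ.* (+ A ℤ.* + B ℤ.* + D)
        ≡⟨ reorder (+ p) X (+ A) (+ B) (+ D) ⟩
      + p ℤ.* (X ℤ.* + B ℤ.* + A ℤ.* + D)
        ∎
      where
      A = w C j
      B = p ^ (k ∸ j)
      N = nonzeroSums p j true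
      D = (n ∸ w) C (k ∸ j)
      X = (+ p) ℤ.^ j ℤ.- (ℤ.- (+ 1)) ℤ.^ j
      regroup : ∀ q a b c d → q ℤ.* (a ℤ.* (b ℤ.* c) ℤ.* d) ≡ (q ℤ.* c) ℤ.* (a ℤ.* b ℤ.* d)
      regroup = solve-∀
      reorder : ∀ p x a b d → (p ℤ.* x) ℤ.* (a ℤ.* b ℤ.* d) ≡ p ℤ.* (x ℤ.* b ℤ.* a ℤ.* d)
      reorder = solve-∀

  q*LHS : ∀ {M n w} (𝒞 : ConstantWeightCode F M n w) k →
          + q ℤ.* + LHS F 𝒞 k ≡ + M ℤ.* (+ p ℤ.* Σℤ k (Pminus-summand k n w))
  q*LHS {M} {n} {w} 𝒞 k = begin
    + q ℤ.* + LHS F 𝒞 k                      ≡⟨ cong (λ L → + q ℤ.* + L) (LHS≡M*rowContribution 𝒞 k) ⟩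
    + q ℤ.* + (M * rowContribution k n w)    ≡⟨ cong (+ q ℤ.*_) (pos-* M (rowContribution k n w)) ⟩
    + q ℤ.* (+ M ℤ.* + rowContribution k n w) ≡⟨ ℤ-x*[y*z]≡y*[x*z] (+ q) (+ M) _ ⟩
    + M ℤ.* (+ q ℤ.* + rowContribution k n w) ≡⟨ cong (+ M ℤ.*_) (q*rowContribution k n w) ⟩
    + M ℤ.* (+ p ℤ.* Σℤ k (Pminus-summand k n w)) ∎
    where open ≡-Reasoning

lemma3p1 : (F : FiniteField) {M n w : ℕ} (𝒞 : ConstantWeightCode F M n w)
           (k : ℕ) → 1 ≤ k → k ≤ n →
           (+ LHS F 𝒞 k / 1) ≡ RHS F M n w k
lemma3p1 F {M} 𝒞 k _ _ =
  ℤ-identity⇒ℚ-identity (FiniteField.q F) {{FiniteField.q-nz F}} (LHS F 𝒞 k) M (p F) _ (q*LHS F 𝒞 k)
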